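{- For all $n'<n$ in $G^+$, if $\widetilde{d}(n)\neq-1$ then $0<\widetilde{d}(n')\le\widetilde{d}(n)$.
   Context: $G$ is a model of Presburger arithmetic (ordered group elementarily equivalent to $\mathbb{Z}$ in $\mathcal{L}_{Pres}=(+,-,0,1,<,\equiv_n)$), $\mathcal{L}\supseteq\mathcal{L}_{Pres}$, $G$ satisfies DC (every $\mathcal{L}$-definable subset of $G$, with parameters, has a supremum in $G\cup\{\infty\}$), $Th(G,\mathcal{L})$ has the exchange property, and $X\subseteq G^+$ is a fixed $\mathcal{L}$-definable set, where $G^+=\{x\in G:x\ge0\}$. For $a\le b$ in $G^+$, $X[a,b]=\{x\in G^+: a+x\in X,\ a+x\le b\}$. Define $\widetilde{d}:G^+\to G^+\cup\{ -1\}$ by $\widetilde{d}(n)=\min\{g>0:\exists a\in G^+\ X[a,a+n]=X[a+g,a+g+n]\}$ if such $g$ exists, and $\widetilde{d}(n)=-1$ otherwise. -}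

module Defs where

open import Data.Nat using (ℕ; zero; suc)
open import Data.Fin using (Fin)
open import Data.Vec using (Vec; []; _∷_; lookup)
open import Data.List using (List)
open import Data.List.Membership.Propositional using (_∈_)
open import Data.Vec.Relation.Unary.All using (All)
open import Data.Product using (Σ; _×_; _,_)
open import Data.Sum using (_⊎_; inj₁; inj₂)
open import Data.Empty using (⊥)
open import Relation.Binary.PropositionalEquality using (_≡_)
import Data.Integer as ℤ
open import Data.Integer using (ℤ)
import Data.Integer.Divisibility as ℤDiv

data PFun : ℕ → Set where
  plusS  : PFun 2
  negS   : PFun 1
  zeroS  : PFun 0
  oneS   : PFun 0

-- Presburger relation symbols: '<' and the congruences ≡_{k+1} (k : ℕ)
data PRel : ℕ → Set where
  ltS   : PRel 2
  congS : ℕ → PRel 2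

record Language : Set₁ where
  field
    ExFun : ℕ → Set
    ExRel : ℕ → Set

open Language public

Fun : Language → ℕ → Set
Fun L k = PFun k ⊎ ExFun L k

Rel : Language → ℕ → Set
Rel L k = PRel k ⊎ ExRel L k

LPres : Language
LPres = record { ExFun = λ _ → ⊥ ; ExRel = λ _ → ⊥ }

-- Terms / formulas with n free variables (de Bruijn, var zero = innermost)
data Term (L : Language) (n : ℕ) : Set where
  var : Fin n → Term L n
  app : ∀ {k} → Fun L k → Vec (Term L n) k → Term L n

data Formula (L : Language) : ℕ → Set where
  falsum : ∀ {n} → Formula L n
  rel    : ∀ {n k} → Rel L k → Vec (Term L n) k → Formula L n
  equ    : ∀ {n} → Term L n → Term L n → Formula L n
  _⇒_    : ∀ {n} → Formula L n → Formula L n → Formula L n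
  _∧_    : ∀ {n} → Formula L n → Formula L n → Formula L n
  _∨_    : ∀ {n} → Formula L n → Formula L n → Formula L n
  all    : ∀ {n} → Formula L (suc n) → Formula L n
  ex     : ∀ {n} → Formula L (suc n) → Formula L n

Sentence : Language → Set
Sentence L = Formula L 0

record Structure (L : Language) : Set₁ where
  field
    Carrier : Set
    funI    : ∀ {k} → Fun L k → Vec Carrier k → Carrier
    relI    : ∀ {k} → Rel L k → Vec Carrier k → Set

open Structure public

module _ {L : Language} (M : Structure L) where
  mutual
    evalT : ∀ {n} → Vec (Carrier M) n → Term L n → Carrier M
    evalT ρ (var i)    = lookup ρ i
    evalT ρ (app f ts) = funI M f (evalTs ρ ts)

    evalTs : ∀ {n k} → Vec (Carrier M) n → Vec (Term L n) k → Vec (Carrier M) k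
    evalTs ρ []       = []
    evalTs ρ (t ∷ ts) = evalT ρ t ∷ evalTs ρ ts

  Sat : ∀ {n} → Formula L n → Vec (Carrier M) n → Set
  Sat falsum     ρ = ⊥
  Sat (rel R ts) ρ = relI M R (evalTs ρ ts)
  Sat (equ t u)  ρ = evalT ρ t ≡ evalT ρ u
  Sat (φ ⇒ ψ)    ρ = Sat φ ρ → Sat ψ ρ
  Sat (φ ∧ ψ)    ρ = Sat φ ρ × Sat ψ ρ
  Sat (φ ∨ ψ)    ρ = Sat φ ρ ⊎ Sat ψ ρ
  Sat (all φ)    ρ = (x : Carrier M) → Sat φ (x ∷ ρ)
  Sat (ex φ)     ρ = Σ (Carrier M) λ x → Sat φ (x ∷ ρ)

  Models : Sentence L → Set
  Models σ = Sat σ []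

ElemEquiv : {L : Language} → Structure L → Structure L → Set
ElemEquiv {L} M N = (σ : Sentence L) → (Models M σ → Models N σ) × (Models N σ → Models M σ)

reduct : {L : Language} → Structure L → Structure LPres
reduct M = record
  { Carrier = Carrier M
  ; funI = λ { (inj₁ f) vs → funI M (inj₁ f) vs ; (inj₂ ()) _ }
  ; relI = λ { (inj₁ r) vs → relI M (inj₁ r) vs ; (inj₂ ()) _ }
  }

ℤfun : ∀ {k} → Fun LPres k → Vec ℤ k → ℤ
ℤfun (inj₁ plusS) (x ∷ y ∷ []) = x ℤ.+ y
ℤfun (inj₁ negS)  (x ∷ [])     = ℤ.- x
ℤfun (inj₁ zeroS) []           = ℤ.+ 0
ℤfun (inj₁ oneS)  []           = ℤ.+ 1
ℤfun (inj₂ ())    _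

ℤrel : ∀ {k} → Rel LPres k → Vec ℤ k → Set
ℤrel (inj₁ ltS)       (x ∷ y ∷ []) = x ℤ.< y
ℤrel (inj₁ (congS k)) (x ∷ y ∷ []) = ℤ.+ (suc k) ℤDiv.∣ (x ℤ.- y)
ℤrel (inj₂ ())        _

ℤstr : Structure LPres
ℤstr = record { Carrier = ℤ ; funI = ℤfun ; relI = ℤrel }

PresModel : {L : Language} → Structure L → Set
PresModel G = ElemEquiv (reduct G) ℤstr

module _ {L : Language} (G : Structure L) where
  private C = Carrier G

  _<G_ : C → C → Set
  x <G y = relI G (inj₁ ltS) (x ∷ y ∷ [])

  _≤G_ : C → C → Set
  x ≤G y = x <G y ⊎ x ≡ y

  _+G_ : C → C → C
  x +G y = funI G (inj₁ plusS) (x ∷ y ∷ [])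

  0G : C
  0G = funI G (inj₁ zeroS) []

  1G : C
  1G = funI G (inj₁ oneS) []

  -1G : C
  -1G = funI G (inj₁ negS) (1G ∷ [])

  Definable : (C → Set) → Set
  Definable S = Σ ℕ λ k → Σ (Formula L (suc k)) λ φ → Σ (Vec C k) λ ps →
                  (x : C) → (S x → Sat G φ (x ∷ ps)) × (Sat G φ (x ∷ ps) → S x)

  -- sup S = ∞  (constructive reading: S is cofinal)
  SupIsInfinity : (C → Set) → Set
  SupIsInfinity S = (g : C) → Σ C λ x → S x × g <G x

  -- s = sup S (constructive reading: upper bound, approximable from below)
  IsSup : (C → Set) → C → Set
  IsSup S s = ((x : C) → S x → x ≤G s) × ((t : C) → t <G s → Σ C λ x → S x × t <G x)

  DC : Set₁
  DC = (S : C → Set) → Definable S → Σ C S → SupIsInfinity S ⊎ Σ C (IsSup S)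

  module _ (M : Structure L) where
    InAcl : (Carrier M → Set) → Carrier M → Set
    InAcl A b = Σ ℕ λ k → Σ (Formula L (suc k)) λ φ → Σ (Vec (Carrier M) k) λ ps →
                  All A ps × Sat M φ (b ∷ ps) ×
                  Σ (List (Carrier M)) λ ys → (y : Carrier M) → Sat M φ (y ∷ ps) → y ∈ ys

    ExchangeIn : Set₁
    ExchangeIn = (A : Carrier M → Set) (b c : Carrier M) →
                 InAcl (λ x → A x ⊎ x ≡ c) b → (InAcl A b → ⊥) →
                 InAcl (λ x → A x ⊎ x ≡ b) c

  ExchangeProperty : Set₁
  ExchangeProperty = (M : Structure L) → ElemEquiv M G → ExchangeIn M

  module _ (X : C → Set) where
    -- X[a,b] = {x ∈ G⁺ : a+x ∈ X, a+x ≤ b}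
    Seg : C → C → C → Set
    Seg a b x = 0G ≤G x × X (a +G x) × (a +G x) ≤G b

    SameSet : (C → Set) → (C → Set) → Set
    SameSet P Q = (x : C) → (P x → Q x) × (Q x → P x)

    Period : C → C → Set
    Period n g = 0G <G g × Σ C λ a → 0G ≤G a ×
                   SameSet (Seg a (a +G n)) (Seg (a +G g) ((a +G g) +G n))

    -- d̃(n) = v  (as a graph: v is the least such g, or v = -1 if none)
    DtildeIs : C → C → Set
    DtildeIs n v = (Period n v × ((g : C) → Period n g → v ≤G g))
                 ⊎ (v ≡ -1G × (Σ C (Period n) → ⊥))

module Submission where

-- Since d̃(n) ≠ -1, d̃(n) is the least period of X for window length n.  Two facts finish it.
--   * Periods pass to shorter windows: if X[a,a+n] = X[a+g,a+g+n] and n′ < n, then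
--     X[a,a+n′] = X[a+g,a+g+n′].  So d̃(n) is a period for n′ as well.
--   * Least element principle: in a Presburger model with DC, a nonempty definable set P of
--     positive elements has a least element.  DC applied to -P (bounded above by 0) gives a
--     supremum s ∈ G; nothing lies strictly between s-1 and s, so s ∈ -P and -s = min P.
-- The periods for n′ form a definable set when X is definable, so d̃(n′) is its least element,
-- which is ≤ d̃(n).
-- Order of the file: renaming of variables and pulling definable sets back along terms; the
-- Presburger facts used, proved in ℤ and transferred to G; the two facts above; the theorem.

open import Defs
open import Data.Nat using (ℕ; zero; suc) renaming (_+_ to _+ℕ_)
open import Data.Fin using (Fin; zero; suc; lift; _↑ʳ_)
open import Data.Vec using (Vec; []; _∷_; lookup; _++_)
open import Data.Vec.Properties using (lookup-++ʳ)
open import Data.Product using (Σ; _×_; _,_; proj₁; proj₂)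
open import Data.Sum using (_⊎_; inj₁; inj₂)
open import Data.Empty using (⊥; ⊥-elim)
open import Relation.Nullary using (yes; no)
open import Relation.Binary.PropositionalEquality
import Data.Integer as ℤ
open import Data.Integer.Properties

infix 3 _⟺_
_⟺_ : Set → Set → Set
A ⟺ B = (A → B) × (B → A)

⟺-sym : ∀ {A B : Set} → A ⟺ B → B ⟺ A
⟺-sym (to , from) = from , to

mutual
  renT : ∀ {L n m} → (Fin n → Fin m) → Term L n → Term L m
  renT ρ (var i)    = var (ρ i)
  renT ρ (app f ts) = app f (renTs ρ ts)

  renTs : ∀ {L n m k} → (Fin n → Fin m) → Vec (Term L n) k → Vec (Term L m) k
  renTs ρ []       = []
  renTs ρ (t ∷ ts) = renT ρ t ∷ renTs ρ ts

ren : ∀ {L n m} → (Fin n → Fin m) → Formula L n → Formula L m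
ren ρ falsum     = falsum
ren ρ (rel R ts) = rel R (renTs ρ ts)
ren ρ (equ t u)  = equ (renT ρ t) (renT ρ u)
ren ρ (φ ⇒ ψ)    = ren ρ φ ⇒ ren ρ ψ
ren ρ (φ ∧ ψ)    = ren ρ φ ∧ ren ρ ψ
ren ρ (φ ∨ ψ)    = ren ρ φ ∨ ren ρ ψ
ren ρ (all φ)    = all (ren (lift 1 ρ) φ)
ren ρ (ex φ)     = ex (ren (lift 1 ρ) φ)

module RenamingSemantics {L : Language} (M : Structure L) where

  Agree : ∀ {n m} → (Fin n → Fin m) → Vec (Carrier M) m → Vec (Carrier M) n → Set
  Agree ρ e e′ = ∀ i → lookup e′ i ≡ lookup e (ρ i)

  agree-lift : ∀ {n m} {ρ : Fin n → Fin m} {e e′} (x : Carrier M) →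
               Agree ρ e e′ → Agree (lift 1 ρ) (x ∷ e) (x ∷ e′)
  agree-lift x ag zero    = refl
  agree-lift x ag (suc i) = ag i

  mutual
    renT-sem : ∀ {n m} {ρ : Fin n → Fin m} {e e′} → Agree ρ e e′ → (t : Term L n) →
               evalT M e (renT ρ t) ≡ evalT M e′ t
    renT-sem ag (var i)    = sym (ag i)
    renT-sem ag (app f ts) = cong (funI M f) (renTs-sem ag ts)

    renTs-sem : ∀ {n m k} {ρ : Fin n → Fin m} {e e′} → Agree ρ e e′ → (ts : Vec (Term L n) k) →
                evalTs M e (renTs ρ ts) ≡ evalTs M e′ ts
    renTs-sem ag []       = refl
    renTs-sem ag (t ∷ ts) = cong₂ _∷_ (renT-sem ag t) (renTs-sem ag ts)

  ren-sem : ∀ {n m} {ρ : Fin n → Fin m} {e e′} → Agree ρ e e′ → (φ : Formula L n) →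
            Sat M (ren ρ φ) e ⟺ Sat M φ e′
  ren-sem ag falsum     = (λ x → x) , (λ x → x)
  ren-sem ag (rel R ts) = subst (relI M R) (renTs-sem ag ts) , subst (relI M R) (sym (renTs-sem ag ts))
  ren-sem ag (equ t u)  = (λ p → trans (sym (renT-sem ag t)) (trans p (renT-sem ag u))) ,
                          (λ p → trans (renT-sem ag t) (trans p (sym (renT-sem ag u))))
  ren-sem ag (φ ⇒ ψ) with ren-sem ag φ | ren-sem ag ψ
  ... | (φ→ , φ←) | (ψ→ , ψ←) = (λ f x → ψ→ (f (φ← x))) , (λ f x → ψ← (f (φ→ x)))
  ren-sem ag (φ ∧ ψ) with ren-sem ag φ | ren-sem ag ψ
  ... | (φ→ , φ←) | (ψ→ , ψ←) = (λ { (a , b) → φ→ a , ψ→ b }) , (λ { (a , b) → φ← a , ψ← b })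
  ren-sem ag (φ ∨ ψ) with ren-sem ag φ | ren-sem ag ψ
  ... | (φ→ , φ←) | (ψ→ , ψ←) = (λ { (inj₁ a) → inj₁ (φ→ a) ; (inj₂ b) → inj₂ (ψ→ b) }) ,
                                (λ { (inj₁ a) → inj₁ (φ← a) ; (inj₂ b) → inj₂ (ψ← b) })
  ren-sem ag (all φ) = (λ f x → proj₁ (ren-sem (agree-lift x ag) φ) (f x)) ,
                       (λ f x → proj₂ (ren-sem (agree-lift x ag) φ) (f x))
  ren-sem ag (ex φ)  = (λ { (x , s) → x , proj₁ (ren-sem (agree-lift x ag) φ) s }) ,
                       (λ { (x , s) → x , proj₂ (ren-sem (agree-lift x ag) φ) s })

infixl 6 _⊕_
_⊕_ : ∀ {L n} → Term L n → Term L n → Term L n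
t ⊕ u = app (inj₁ plusS) (t ∷ u ∷ [])

𝟘 𝟙 : ∀ {L n} → Term L n
𝟘 = app (inj₁ zeroS) []
𝟙 = app (inj₁ oneS) []

neg : ∀ {L n} → Term L n → Term L n
neg t = app (inj₁ negS) (t ∷ [])

lt le : ∀ {L n} → Term L n → Term L n → Formula L n
lt t u = rel (inj₁ ltS) (t ∷ u ∷ [])
le t u = lt t u ∨ equ t u

v0 : ∀ {L n} → Term L (suc n)
v0 = var zero
v1 : ∀ {L n} → Term L (suc (suc n))
v1 = var (suc zero)
v2 : ∀ {L n} → Term L (suc (suc (suc n)))
v2 = var (suc (suc zero))
v3 : ∀ {L n} → Term L (suc (suc (suc (suc n))))
v3 = var (suc (suc (suc zero)))

module PullBack {L : Language} (G : Structure L) {X : Carrier G → Set}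
                (k : ℕ) (φ : Formula L (suc k)) (ps : Vec (Carrier G) k)
                (defX : (x : Carrier G) → X x ⟺ Sat G φ (x ∷ ps)) where
  open RenamingSemantics G

  atTerm : ∀ {n} → Term L (n +ℕ k) → Formula L (n +ℕ k)
  atTerm {n} t = ex (equ v0 (renT suc t) ∧ ren (lift 1 (n ↑ʳ_)) φ)

  atTerm-sem : ∀ {n} (t : Term L (n +ℕ k)) (e : Vec (Carrier G) n) →
               Sat G (atTerm t) (e ++ ps) ⟺ X (evalT G (e ++ ps) t)
  atTerm-sem {n} t e =
      (λ { (z , z≡t , s) → subst X (trans z≡t (weaken z)) (proj₂ (defX z) (proj₁ (ren-sem (toParams z) φ) s)) })
    , (λ Xt → _ , sym (weaken _) , proj₂ (ren-sem (toParams _) φ) (proj₁ (defX _) Xt))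
    where
    -- the bound variable is a fresh head; the parameters sit behind the n extra variables
    weaken : ∀ z → evalT G (z ∷ e ++ ps) (renT suc t) ≡ evalT G (e ++ ps) t
    weaken z = renT-sem {ρ = suc} (λ i → refl) t
    toParams : ∀ z → Agree (lift 1 (n ↑ʳ_)) (z ∷ e ++ ps) (z ∷ ps)
    toParams z = agree-lift z (λ i → sym (lookup-++ʳ e ps i))

module IntegerFacts where
  open ℤ using (_+_; -_; +_; _<_; _≤_)

  _≤′_ : ℤ.ℤ → ℤ.ℤ → Set
  x ≤′ y = x < y ⊎ x ≡ y

  ≤′⇒≤ : ∀ {x y} → x ≤′ y → x ≤ y
  ≤′⇒≤ (inj₁ x<y)  = <⇒≤ x<y
  ≤′⇒≤ (inj₂ refl) = ≤-refl

  ≤⇒≤′ : ∀ {x y} → x ≤ y → x ≤′ y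
  ≤⇒≤′ {x} {y} x≤y with x ℤ.≟ y
  ... | yes x≡y = inj₂ x≡y
  ... | no  x≢y = inj₁ (≤∧≢⇒< x≤y x≢y)

  neg-cancelˡ : ∀ b x → - b + (b + x) ≡ x
  neg-cancelˡ b x = trans (sym (+-assoc (- b) b x)) (trans (cong (_+ x) (+-inverseˡ b)) (+-identityˡ x))

  +-cancelˡ-≤ : ∀ b x m → b + x ≤ b + m → x ≤ m
  +-cancelˡ-≤ b x m p = subst₂ _≤_ (neg-cancelˡ b x) (neg-cancelˡ b m) (+-monoʳ-≤ (- b) p)

  inverse-unique : ∀ a b → a + b ≡ + 0 → b ≡ - a
  inverse-unique a b e = trans (sym (neg-cancelˡ a b)) (trans (cong (λ z → - a + z) e) (+-identityʳ (- a)))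

open IntegerFacts using (≤′⇒≤; ≤⇒≤′; +-cancelˡ-≤; inverse-unique)

-- Elementary Presburger facts.  Each is written as an L_Pres-sentence and proved in ℤ; since
-- the L_Pres-reduct of a Presburger model G is elementarily equivalent to ℤ, it holds in G.

inverseˡ-sentence : Sentence LPres
inverseˡ-sentence = all (equ (neg v0 ⊕ v0) 𝟘)

inverseˡ-ℤ : Models ℤstr inverseˡ-sentence
inverseˡ-ℤ x = +-inverseˡ x

no-positive-inverse-sentence : Sentence LPres
no-positive-inverse-sentence = all (all (equ (v1 ⊕ v0) 𝟘 ⇒ (lt 𝟘 v0 ⇒ (lt 𝟘 v1 ⇒ falsum))))

no-positive-inverse-ℤ : Models ℤstr no-positive-inverse-sentence
no-positive-inverse-ℤ x h x+h≡0 0<h 0<x =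
  <-irrefl (sym x+h≡0) (subst (ℤ._< x ℤ.+ h) (+-identityˡ (ℤ.+ 0)) (+-mono-< 0<x 0<h))

predecessor-below-sentence : Sentence LPres
predecessor-below-sentence = all (lt (v0 ⊕ neg 𝟙) v0)

predecessor-below-ℤ : Models ℤstr predecessor-below-sentence
predecessor-below-ℤ s = i≤pred[j]⇒i<j (≤-reflexive (+-comm s (ℤ.- ℤ.+ 1)))

discrete-sentence : Sentence LPres
discrete-sentence = all (all (lt (v1 ⊕ neg 𝟙) v0 ⇒ (lt v0 v1 ⇒ falsum)))

discrete-ℤ : Models ℤstr discrete-sentence
discrete-ℤ s x s-1<x x<s = ≤⇒≯ (subst (ℤ._≤ x) suc-pred′ (i<j⇒suc[i]≤j s-1<x)) x<s
  where
  suc-pred′ : ℤ.suc (s ℤ.+ ℤ.- ℤ.+ 1) ≡ s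
  suc-pred′ = trans (+-comm (ℤ.+ 1) (s ℤ.+ ℤ.- ℤ.+ 1)) (trans (+-assoc s (ℤ.- ℤ.+ 1) (ℤ.+ 1)) (+-identityʳ s))

negation-antitone-sentence : Sentence LPres
negation-antitone-sentence =
  all (all (all (all (equ (v3 ⊕ v0) 𝟘 ⇒ (equ (v2 ⊕ v1) 𝟘 ⇒ (le v3 v2 ⇒ le v1 v0))))))

negation-antitone-ℤ : Models ℤstr negation-antitone-sentence
negation-antitone-ℤ y x g h y+h≡0 x+g≡0 y≤x =
  ≤⇒≤′ (subst₂ ℤ._≤_ (sym (inverse-unique x g x+g≡0)) (sym (inverse-unique y h y+h≡0))
                    (neg-mono-≤ (≤′⇒≤ y≤x)))

window-enlarge-sentence : Sentence LPres
window-enlarge-sentence =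
  all (all (all (all (le (v3 ⊕ v2) (v3 ⊕ v1) ⇒ (lt v1 v0 ⇒ le (v3 ⊕ v2) (v3 ⊕ v0))))))

window-enlarge-ℤ : Models ℤstr window-enlarge-sentence
window-enlarge-ℤ b x m n b+x≤b+m m<n =
  inj₁ (+-monoʳ-< b (≤-<-trans (+-cancelˡ-≤ b x m (≤′⇒≤ b+x≤b+m)) m<n))

window-shift-sentence : Sentence LPres
window-shift-sentence = all (all (all (all (le (v3 ⊕ v1) (v3 ⊕ v0) ⇒ le (v2 ⊕ v1) (v2 ⊕ v0)))))

window-shift-ℤ : Models ℤstr window-shift-sentence
window-shift-ℤ b c x m b+x≤b+m = ≤⇒≤′ (+-monoʳ-≤ c (+-cancelˡ-≤ b x m (≤′⇒≤ b+x≤b+m)))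

module PresburgerFacts {L : Language} (G : Structure L) (pres : PresModel G) where
  private
    C = Carrier G
    _+'_ = _+G_ G
    _<'_ = _<G_ G
    _≤'_ = _≤G_ G

  negG : C → C
  negG x = funI G (inj₁ negS) (x ∷ [])

  transfer : (σ : Sentence LPres) → Models ℤstr σ → Models (reduct G) σ
  transfer σ = proj₂ (pres σ)

  inverseˡ : (x : C) → negG x +' x ≡ 0G G
  inverseˡ = transfer inverseˡ-sentence inverseˡ-ℤ

  no-positive-inverse : (x h : C) → x +' h ≡ 0G G → 0G G <' h → 0G G <' x → ⊥
  no-positive-inverse = transfer no-positive-inverse-sentence no-positive-inverse-ℤ

  predecessor-below : (s : C) → (s +' -1G G) <' s
  predecessor-below = transfer predecessor-below-sentence predecessor-below-ℤ

  discrete : (s x : C) → (s +' -1G G) <' x → x <' s → ⊥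
  discrete = transfer discrete-sentence discrete-ℤ

  negation-antitone : (y x g h : C) → y +' h ≡ 0G G → x +' g ≡ 0G G → y ≤' x → g ≤' h
  negation-antitone = transfer negation-antitone-sentence negation-antitone-ℤ

  window-enlarge : (b x m n : C) → (b +' x) ≤' (b +' m) → m <' n → (b +' x) ≤' (b +' n)
  window-enlarge = transfer window-enlarge-sentence window-enlarge-ℤ

  window-shift : (b c x m : C) → (b +' x) ≤' (b +' m) → (c +' x) ≤' (c +' m)
  window-shift = transfer window-shift-sentence window-shift-ℤ

module Negation {L : Language} (G : Structure L) where
  Negated : (Carrier G → Set) → Carrier G → Set
  Negated P y = Σ (Carrier G) λ g → P g × (_+G_ G y g ≡ 0G G)

  negated-definable : (P : Carrier G → Set) → Definable G P → Definable G (Negated P)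
  negated-definable P (k , φ , ps , defP) =
      k , ex (atTerm {n = 2} v0 ∧ equ (v1 ⊕ v0) 𝟘) , ps
    , λ y → (λ { (g , Pg , y+g≡0) → g , proj₂ (P-at g y) Pg , y+g≡0 })
          , (λ { (g , s , y+g≡0) → g , proj₁ (P-at g y) s , y+g≡0 })
    where
    open PullBack G k φ ps defP
    P-at : ∀ g y → Sat G (atTerm {n = 2} v0) (g ∷ y ∷ ps) ⟺ P g
    P-at g y = atTerm-sem v0 (g ∷ y ∷ [])

module LeastElement {L : Language} (G : Structure L) (pres : PresModel G) (dc : DC G) where
  open PresburgerFacts G pres
  open Negation G
  private C = Carrier G

  -- in the discrete order of G, a supremum lying in G belongs to the set
  supremum-attained : (S : C → Set) (s : C) → IsSup G S s → S s
  supremum-attained S s (upper , approx) with approx (_+G_ G s (-1G G)) (predecessor-below s)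
  ... | x , Sx , s-1<x with upper x Sx
  ...   | inj₁ x<s  = ⊥-elim (discrete s x s-1<x x<s)
  ...   | inj₂ refl = Sx

  least-element : (P : C → Set) → Definable G P → ((g : C) → P g → _<G_ G (0G G) g) → Σ C P →
                  Σ C λ m → P m × ((g : C) → P g → _≤G_ G m g)
  least-element P defP positive (g₀ , Pg₀)
    with dc (Negated P) (negated-definable P defP) (negG g₀ , g₀ , Pg₀ , inverseˡ g₀)
  -- -P lies below 0, so it is not cofinal
  ... | inj₁ cofinal with cofinal (0G G)
  ...   | x , (g , Pg , x+g≡0) , 0<x = ⊥-elim (no-positive-inverse x g x+g≡0 (positive g Pg) 0<x)
  -- its supremum s is attained, and s = -m with m the least element of P
  least-element P defP positive (g₀ , Pg₀) | inj₂ (s , sup) with supremum-attained (Negated P) s sup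
  ... | m , Pm , s+m≡0 = m , Pm , λ h Ph →
          negation-antitone (negG h) s m h (inverseˡ h) s+m≡0 (proj₁ sup (negG h) (h , Ph , inverseˡ h))

module Periods {L : Language} (G : Structure L) (X : Carrier G → Set) where
  private
    C = Carrier G
    _+'_ = _+G_ G

  period-restrict : PresModel G → (n′ n : C) → _<G_ G n′ n → (g : C) → Period G X n g → Period G X n′ g
  period-restrict pres n′ n n′<n g (0<g , a , 0≤a , same) = 0<g , a , 0≤a , λ x → shrink a (a +' g) same x , shrink (a +' g) a (swap same) x
    where
    open PresburgerFacts G pres
    swap : ∀ {P Q} → SameSet G X P Q → SameSet G X Q P
    swap same x = proj₂ (same x) , proj₁ (same x)
    -- an element of X[b,b+n′] lies in X[b,b+n], hence (by `same`) in X[c,c+n], hence in X[c,c+n′]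
    shrink : ∀ b c → SameSet G X (Seg G X b (b +' n)) (Seg G X c (c +' n)) →
             ∀ x → Seg G X b (b +' n′) x → Seg G X c (c +' n′) x
    shrink b c same x (0≤x , Xbx , b+x≤b+n′) with proj₁ (same x) (0≤x , Xbx , window-enlarge b x n′ n b+x≤b+n′ n′<n)
    ... | _ , Xcx , _ = 0≤x , Xcx , window-shift b c x n′ b+x≤b+n′

  sameSet-resp : ∀ {P P′ Q Q′ : C → Set} → (∀ x → P x ⟺ P′ x) → (∀ x → Q x ⟺ Q′ x) →
                 SameSet G X P Q → SameSet G X P′ Q′
  sameSet-resp P⟺P′ Q⟺Q′ same x =
      (λ p → proj₁ (Q⟺Q′ x) (proj₁ (same x) (proj₂ (P⟺P′ x) p)))
    , (λ q → proj₁ (P⟺P′ x) (proj₂ (same x) (proj₂ (Q⟺Q′ x) q)))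

  period-definable : Definable G X → (m : C) → Definable G (Period G X m)
  period-definable (k , φ , ps , defX) m = suc k , periodF , m ∷ ps , λ g → to g , from g
    where
    open PullBack G k φ ps defX

    -- X[b,c] as a formula with the element as variable 0
    segmentF : ∀ {n} → Term L (suc n +ℕ k) → Term L (suc n +ℕ k) → Formula L (suc n +ℕ k)
    segmentF b c = le 𝟘 v0 ∧ (atTerm (b ⊕ v0) ∧ le (b ⊕ v0) c)

    segmentF-sem : ∀ {n} (b c : Term L (suc n +ℕ k)) x (e : Vec C n) →
                   Sat G (segmentF b c) ((x ∷ e) ++ ps) ⟺
                   Seg G X (evalT G ((x ∷ e) ++ ps) b) (evalT G ((x ∷ e) ++ ps) c) x
    segmentF-sem b c x e with atTerm-sem (b ⊕ v0) (x ∷ e)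
    ... | X→ , X← = (λ { (0≤x , s , b+x≤c) → 0≤x , X→ s , b+x≤c })
                  , (λ { (0≤x , s , b+x≤c) → 0≤x , X← s , b+x≤c })

    -- variables: x = v0, a = v1, g = v2, m = v3
    seg₁ seg₂ : Formula L (4 +ℕ k)
    seg₁ = segmentF v1 (v1 ⊕ v3)
    seg₂ = segmentF (v1 ⊕ v2) (v1 ⊕ v2 ⊕ v3)

    periodF : Formula L (2 +ℕ k)
    periodF = lt 𝟘 v0 ∧ ex (le 𝟘 v0 ∧ all ((seg₁ ⇒ seg₂) ∧ (seg₂ ⇒ seg₁)))

    seg₁-sem : ∀ g a x → Sat G seg₁ (x ∷ a ∷ g ∷ m ∷ ps) ⟺ Seg G X a (a +' m) x
    seg₁-sem g a x = segmentF-sem v1 (v1 ⊕ v3) x (a ∷ g ∷ m ∷ [])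

    seg₂-sem : ∀ g a x → Sat G seg₂ (x ∷ a ∷ g ∷ m ∷ ps) ⟺ Seg G X (a +' g) ((a +' g) +' m) x
    seg₂-sem g a x = segmentF-sem (v1 ⊕ v2) (v1 ⊕ v2 ⊕ v3) x (a ∷ g ∷ m ∷ [])

    to : ∀ g → Period G X m g → Sat G periodF (g ∷ m ∷ ps)
    to g (0<g , a , 0≤a , same) =
      0<g , a , 0≤a , sameSet-resp (λ x → ⟺-sym (seg₁-sem g a x)) (λ x → ⟺-sym (seg₂-sem g a x)) same

    from : ∀ g → Sat G periodF (g ∷ m ∷ ps) → Period G X m g
    from g (0<g , a , 0≤a , same) = 0<g , a , 0≤a , sameSet-resp (seg₁-sem g a) (seg₂-sem g a) same

mainTheorem7 : (L : Language) (G : Structure L) → PresModel G → DC G → ExchangeProperty G →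
    (X : Carrier G → Set) → Definable G X → ((x : Carrier G) → X x → _≤G_ G (0G G) x) →
    (n′ n : Carrier G) → _≤G_ G (0G G) n′ → _<G_ G n′ n →
    (dn : Carrier G) → DtildeIs G X n dn → (dn ≡ -1G G → ⊥) →
    Σ (Carrier G) λ dn′ → DtildeIs G X n′ dn′ × _<G_ G (0G G) dn′ × _≤G_ G dn′ dn
mainTheorem7 L G pres dc _ X defX _ n′ n _ n′<n dn (inj₂ (dn≡-1 , _)) dn≢-1 = ⊥-elim (dn≢-1 dn≡-1)
mainTheorem7 L G pres dc _ X defX _ n′ n _ n′<n dn (inj₁ (dn-period , _)) _ =
  let (dn′ , dn′-period , dn′-least) = least-period
  in  dn′ , inj₁ (dn′-period , dn′-least) , proj₁ dn′-period , dn′-least dn dn-period′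
  where
  open Periods G X
  open LeastElement G pres dc

  dn-period′ : Period G X n′ dn
  dn-period′ = period-restrict pres n′ n n′<n dn dn-period

  least-period : Σ (Carrier G) λ m → Period G X n′ m × ((g : Carrier G) → Period G X n′ g → _≤G_ G m g)
  least-period = least-element (Period G X n′) (period-definable defX n′) (λ g → proj₁) (dn , dn-period′)
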